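{- Let $u,v\in S_n$ have the same length. If $\theta_{\mathsf{D}_u}(S)=\theta_{\mathsf{D}_v}(S)$ for all sets $S=\{i,i+1,\ldots,n\}$ with $1\leq i\leq n$, then $u=v$.
   Context: A diagram $\mathsf{D}$ is a subset of the $n\times n$ grid $[n]\times[n]$, with $(r,c)$ denoting row $r$ (rows numbered top to bottom) and column $c$. The Rothe diagram of $w\in S_n$ is $\mathsf{D}_w=\{(i,j):w(i)>j\text{ and }w^{ -1}(j)>i\}$. For $S\subseteq[n]$ and a column $c$, let $\mathtt{word}_{c,S}(\mathsf{D})$ be the word obtained by reading rows $r=1,\ldots,n$ of column $c$ and recording "(" if $(r,c)\notin\mathsf{D}$ and $r\in S$, ")" if $(r,c)\in\mathsf{D}$ and $r\notin S$, "$\star$" if $(r,c)\in\mathsf{D}$ and $r\in S$, and nothing otherwise. Let $\theta^c_{\mathsf{D}}(S)$ be the number of matched pairs "()" in this word under the usual parenthesis matching (ignoring $\star$'s) plus the number of $\star$'s, and $\theta_{\mathsf{D}}(S)=\sum_{c\in[n]}\theta^c_{\mathsf{D}}(S)$. -}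

module Defs where

open import Data.Nat using (ℕ; zero; suc; _+_)
open import Data.Bool using (Bool; true; false; if_then_else_)
open import Data.Fin using (Fin; _<?_; _≤?_)
open import Data.Fin.Permutation using (Permutation′; _⟨$⟩ʳ_; _⟨$⟩ˡ_)
open import Data.List using (List; []; _∷_; map; concatMap; filter; length)
open import Data.Nat.ListAction using (sum)
open import Data.List.Base using ()
open import Data.Fin.Base using ()
open import Data.Vec.Functional using ()
open import Data.Fin.Subset using (Subset)
import Data.Vec
import Data.Bool
open import Relation.Nullary.Decidable using (does; ⌊_⌋)
open import Data.List using (allFin)

-- Conventions: [n] is represented by Fin n (0-indexed), S_n by
-- Permutation′ n; w(i) = w ⟨$⟩ʳ i and w⁻¹(j) = w ⟨$⟩ˡ j.

inRothe : ∀ {n} → Permutation′ n → Fin n → Fin n → Bool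
inRothe w i j = does (j <? (w ⟨$⟩ʳ i)) Data.Bool.∧ does (i <? (w ⟨$⟩ˡ j))

-- A diagram: a Boolean membership predicate on [n] × [n] (row, column).
Diagram : ℕ → Set
Diagram n = Fin n → Fin n → Bool

Rothe : ∀ {n} → Permutation′ n → Diagram n
Rothe = inRothe

-- Coxeter length: number of inversions, i.e. pairs i < j with w(i) > w(j).
len : ∀ {n} → Permutation′ n → ℕ
len {n} w = length (filter (λ p → (Data.Product.proj₁ p) <? (Data.Product.proj₂ p))
                     (filter (λ p → (w ⟨$⟩ʳ Data.Product.proj₂ p) <? (w ⟨$⟩ʳ Data.Product.proj₁ p))
                       (concatMap (λ i → map (λ j → i Data.Product., j) (allFin n)) (allFin n))))
  where import Data.Product

data Letter : Set where
  open′ close star : Letter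

letter : Bool → Bool → List Letter
letter false true  = open′ ∷ []   -- (r,c) ∉ D, r ∈ S
letter true  false = close ∷ []   -- (r,c) ∈ D, r ∉ S
letter true  true  = star ∷ []    -- (r,c) ∈ D, r ∈ S
letter false false = []

word : ∀ {n} → Diagram n → Subset n → Fin n → List Letter
word {n} D S c = concatMap (λ r → letter (D r c) (Data.Vec.lookup S r)) (allFin n)

-- Usual parenthesis matching (stars ignored): scan left to right with a
-- counter of unmatched "("; a ")" is matched iff the counter is positive.
-- Returns (#matched pairs) + (#stars).
thetaWord : ℕ → List Letter → ℕ
thetaWord k []              = 0
thetaWord k (open′ ∷ w)     = thetaWord (suc k) w
thetaWord zero (close ∷ w)  = thetaWord zero w
thetaWord (suc k) (close ∷ w) = suc (thetaWord k w)
thetaWord k (star ∷ w)      = suc (thetaWord k w)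

thetaCol : ∀ {n} → Diagram n → Subset n → Fin n → ℕ
thetaCol D S c = thetaWord 0 (word D S c)

theta : ∀ {n} → Diagram n → Subset n → ℕ
theta {n} D S = sum (map (thetaCol D S) (allFin n))

-- The final segment S = {i, i+1, ..., n} (0-indexed: rows r with i ≤ r).
finalSeg : ∀ {n} → Fin n → Subset n
finalSeg i = Data.Vec.tabulate (λ r → does (i ≤? r))

module Submission where

-- Proof idea.  For a permutation w let code_w(r) be the number of cells of
-- the Rothe diagram D_w in row r (the Lehmer code of w).
--
-- 1. For a final segment S = {i,…,n} the word of every column consists of
--    ")" letters followed by "(" and "⋆" letters only, so no pair is matched
--    and θ^c_D(S) counts the cells of column c in rows ≥ i.  Summing over the
--    columns gives θ_D(S) = Σ_{r ≥ i} code(r)               (theta-finalSeg).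
-- 2. The tail sums Σ_{r ≥ i} A(r), for all i, determine A, so the hypothesis
--    gives code_u = code_v                                  (tailSum-injective).
-- 3. The code determines the permutation: if u and v agree on the rows above
--    r and u(r) < v(r), then row r of D_u is contained in row r of D_v and
--    misses the cell (r, u(r)) of D_v, so code_u(r) < code_v(r).  Strong
--    induction on r gives u = v                               (code-injective).

open import Defs
open import Data.Nat using (ℕ)
open import Data.Fin using (Fin)
open import Data.Fin.Permutation using (Permutation′; _≈_)
open import Relation.Binary.PropositionalEquality using (_≡_)

open import Data.Bool using (Bool; true; false; T; _∧_; if_then_else_)
open import Data.Bool.Properties using (T-∧; T-≡; ∧-identityʳ; ∧-zeroʳ)
open import Data.Empty using (⊥-elim)
open import Data.Fin using (zero; suc; _≤_; _<_; _≤?_; _<?_)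
open import Data.Fin.Induction using (<-wellFounded)
open import Data.Fin.Subset using (Subset)
open import Data.Fin.Permutation using (_⟨$⟩ʳ_; _⟨$⟩ˡ_; inverseˡ; inverseʳ)
import Data.Fin.Properties as Finₚ
open import Data.List using (List; concat; map; tabulate; allFin)
open import Data.List.Properties using (map-tabulate)
import Data.Nat as ℕ
import Data.Nat.Properties as ℕₚ
open import Data.Nat.ListAction using () renaming (sum to sumList)
open import Data.Product using (_×_; _,_; proj₁)
open import Data.Unit using (tt)
open import Data.Vec using (lookup)
open import Data.Vec.Properties using (lookup∘tabulate)
open import Function using (_∘_; id; Equivalence; mk⇔)
open import Induction.WellFounded using (Acc; acc)
open import Relation.Binary.Definitions using (tri<; tri≈; tri>)
open import Relation.Binary.PropositionalEquality
  using (refl; sym; trans; cong; subst; _≢_; module ≡-Reasoning)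
open import Relation.Nullary using (¬_; Dec; does; yes; no)
open import Relation.Nullary.Decidable using (dec-true; does-⇔)
open import Algebra.Properties.CommutativeMonoid.Sum ℕₚ.+-0-commutativeMonoid
  using (sum-syntax; sum-cong-≗; ∑-comm)

𝟙 : Bool → ℕ
𝟙 true  = 1
𝟙 false = 0

count : ∀ {m} → (Fin m → Bool) → ℕ
count {m} p = ∑[ x < m ] 𝟙 (p x)

_⊆_ : ∀ {m} → (Fin m → Bool) → (Fin m → Bool) → Set
p ⊆ q = ∀ x → T (p x) → T (q x)

𝟙-mono : ∀ a b → (T a → T b) → 𝟙 a ℕ.≤ 𝟙 b
𝟙-mono false b     _   = ℕ.z≤n
𝟙-mono true  true  _   = ℕₚ.≤-refl
𝟙-mono true  false a⇒b = ⊥-elim (a⇒b tt)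

count-mono : ∀ {m} (p q : Fin m → Bool) → p ⊆ q → count p ℕ.≤ count q
count-mono {ℕ.zero}  p q p⊆q = ℕ.z≤n
count-mono {ℕ.suc m} p q p⊆q =
  ℕₚ.+-mono-≤ (𝟙-mono (p zero) (q zero) (p⊆q zero)) (count-mono (p ∘ suc) (q ∘ suc) (p⊆q ∘ suc))

count-strict : ∀ {m} (p q : Fin m → Bool) → p ⊆ q →
               (x : Fin m) → ¬ T (p x) → T (q x) → count p ℕ.< count q
count-strict p q p⊆q zero    x∉p x∈q with p zero | q zero
... | false | true  = ℕ.s≤s (count-mono (p ∘ suc) (q ∘ suc) (p⊆q ∘ suc))
... | false | false = ⊥-elim x∈q
... | true  | _     = ⊥-elim (x∉p tt)
count-strict p q p⊆q (suc x) x∉p x∈q =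
  ℕₚ.+-mono-≤-< (𝟙-mono (p zero) (q zero) (p⊆q zero))
                (count-strict (p ∘ suc) (q ∘ suc) (p⊆q ∘ suc) x x∉p x∈q)

does-sound : ∀ {P : Set} (p? : Dec P) → P → T (does p?)
does-sound (yes _) _ = tt
does-sound (no ¬p) p = ¬p p

does-complete : ∀ {P : Set} (p? : Dec P) → T (does p?) → P
does-complete (yes p) _ = p

columnWord : ∀ {m} → (Fin m → Bool) → (Fin m → Bool) → List Letter
columnWord d s = concat (tabulate (λ r → letter (d r) (s r)))

word≡columnWord : ∀ {n} (D : Diagram n) (S : Subset n) (c : Fin n) →
                  word D S c ≡ columnWord (λ r → D r c) (lookup S)
word≡columnWord D S c = cong concat (map-tabulate id (λ r → letter (D r c) (lookup S r)))

-- If every row lies in S the word has no ")" letters: nothing is matched,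
-- whatever the number k of pending "(", and only the stars are counted.
theta-allInS : ∀ {m} (d s : Fin m → Bool) → (∀ r → s r ≡ true) →
               ∀ k → thetaWord k (columnWord d s) ≡ count (λ r → d r ∧ s r)
theta-allInS {ℕ.zero}  d s inS k = refl
theta-allInS {ℕ.suc m} d s inS k rewrite inS zero with d zero
... | true  = cong ℕ.suc (theta-allInS (d ∘ suc) (s ∘ suc) (inS ∘ suc) k)
... | false = theta-allInS (d ∘ suc) (s ∘ suc) (inS ∘ suc) (ℕ.suc k)

UpClosed : ∀ {m} → (Fin m → Bool) → Set
UpClosed s = ∀ {x y} → x ≤ y → s x ≡ true → s y ≡ true

-- For upward closed S the rows outside S come first and only give ")" with no
-- pending "(", which are unmatched; the rest is handled by theta-allInS.
theta-upClosed : ∀ {m} (d s : Fin m → Bool) → UpClosed s →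
                 thetaWord 0 (columnWord d s) ≡ count (λ r → d r ∧ s r)
theta-upClosed {ℕ.zero}  d s up = refl
theta-upClosed {ℕ.suc m} d s up with s zero in s₀ | d zero
... | true  | true  = cong ℕ.suc (theta-allInS (d ∘ suc) (s ∘ suc) (λ _ → up ℕ.z≤n s₀) 0)
... | true  | false = theta-allInS (d ∘ suc) (s ∘ suc) (λ _ → up ℕ.z≤n s₀) 1
... | false | true  = theta-upClosed (d ∘ suc) (s ∘ suc) (up ∘ ℕ.s≤s)
... | false | false = theta-upClosed (d ∘ suc) (s ∘ suc) (up ∘ ℕ.s≤s)

rowCount : ∀ {n} → Diagram n → Fin n → ℕ
rowCount D r = count (D r)

tailSum : ∀ {n} → (Fin n → ℕ) → Fin n → ℕ
tailSum {n} A i = ∑[ r < n ] (if does (i ≤? r) then A r else 0)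

sumList-allFin : ∀ {n} (f : Fin n → ℕ) → sumList (map f (allFin n)) ≡ ∑[ x < n ] f x
sumList-allFin {n} f = trans (cong sumList (map-tabulate id f)) (sumList-tabulate f)
  where
  sumList-tabulate : ∀ {m} (g : Fin m → ℕ) → sumList (tabulate g) ≡ ∑[ x < m ] g x
  sumList-tabulate {ℕ.zero}  g = refl
  sumList-tabulate {ℕ.suc m} g = cong (g zero ℕ.+_) (sumList-tabulate (g ∘ suc))

count-∧ : ∀ {m} (p : Fin m → Bool) (b : Bool) →
          count (λ x → p x ∧ b) ≡ (if b then count p else 0)
count-∧ p true  = sum-cong-≗ (λ x → cong 𝟙 (∧-identityʳ (p x)))
count-∧ {m} p false = trans (sum-cong-≗ (λ x → cong 𝟙 (∧-zeroʳ (p x)))) (zeros m)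
  where
  zeros : ∀ k → ∑[ x < k ] 0 ≡ 0
  zeros ℕ.zero    = refl
  zeros (ℕ.suc k) = zeros k

finalSeg-upClosed : ∀ {n} (i : Fin n) → UpClosed (lookup (finalSeg i))
finalSeg-upClosed {n} i {x} {y} x≤y x∈S =
  trans (lookup∘tabulate inSeg y) (dec-true (i ≤? y) (Finₚ.≤-trans i≤x x≤y))
  where
  inSeg : Fin n → Bool
  inSeg r = does (i ≤? r)
  i≤x : i ≤ x
  i≤x = does-complete (i ≤? x) (Equivalence.from T-≡ (trans (sym (lookup∘tabulate inSeg x)) x∈S))

theta-finalSeg : ∀ {n} (D : Diagram n) (i : Fin n) →
                 theta D (finalSeg i) ≡ tailSum (rowCount D) i
theta-finalSeg {n} D i = begin
  theta D S                                         ≡⟨ sumList-allFin (thetaCol D S) ⟩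
  ∑[ c < n ] thetaCol D S c                         ≡⟨ sum-cong-≗ column ⟩
  ∑[ c < n ] ∑[ r < n ] 𝟙 (D r c ∧ lookup S r)      ≡⟨ ∑-comm (λ c r → 𝟙 (D r c ∧ lookup S r)) ⟩
  ∑[ r < n ] count (λ c → D r c ∧ lookup S r)      ≡⟨ sum-cong-≗ row ⟩
  tailSum (rowCount D) i                            ∎
  where
  open ≡-Reasoning
  S = finalSeg i
  column : ∀ c → thetaCol D S c ≡ count (λ r → D r c ∧ lookup S r)
  column c = trans (cong (thetaWord 0) (word≡columnWord D S c))
                   (theta-upClosed (λ r → D r c) (lookup S) (finalSeg-upClosed i))
  row : ∀ r → count (λ c → D r c ∧ lookup S r) ≡ (if does (i ≤? r) then rowCount D r else 0)
  row r = trans (count-∧ (D r) (lookup S r))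
                (cong (λ b → if b then rowCount D r else 0) (lookup∘tabulate (λ r → does (i ≤? r)) r))

-- Row 0 lies outside every final segment starting at a successor.
tailSum-suc : ∀ {n} (A : Fin (ℕ.suc n) → ℕ) (j : Fin n) → tailSum A (suc j) ≡ tailSum (A ∘ suc) j
tailSum-suc A j = sum-cong-≗ λ r →
  cong (λ b → if b then A (suc r) else 0) (does-⇔ (mk⇔ ℕ.s≤s⁻¹ ℕ.s≤s) (suc j ≤? suc r) (j ≤? r))

tailSum-injective : ∀ {n} (A B : Fin n → ℕ) → (∀ i → tailSum A i ≡ tailSum B i) → ∀ r → A r ≡ B r
tailSum-injective {ℕ.suc n} A B same = λ
  { zero    → ℕₚ.+-cancelʳ-≡ _ (A zero) (B zero) (trans (same zero) (cong (B zero ℕ.+_) (sym rest)))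
  ; (suc r) → below r
  }
  where
  below : ∀ r → A (suc r) ≡ B (suc r)
  below = tailSum-injective (A ∘ suc) (B ∘ suc)
            (λ j → trans (sym (tailSum-suc A j)) (trans (same (suc j)) (tailSum-suc B j)))
  rest : ∑[ r < n ] A (suc r) ≡ ∑[ r < n ] B (suc r)
  rest = sum-cong-≗ below

rothe-intro : ∀ {n} (w : Permutation′ n) {r c : Fin n} →
              c < w ⟨$⟩ʳ r → r < w ⟨$⟩ˡ c → T (Rothe w r c)
rothe-intro w {r} {c} c<wr r<w⁻¹c =
  Equivalence.from T-∧ (does-sound (c <? w ⟨$⟩ʳ r) c<wr , does-sound (r <? w ⟨$⟩ˡ c) r<w⁻¹c)

rothe-elim : ∀ {n} (w : Permutation′ n) {r c : Fin n} →
             T (Rothe w r c) → c < w ⟨$⟩ʳ r × r < w ⟨$⟩ˡ c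
rothe-elim w {r} {c} rc∈D with Equivalence.to (T-∧ {does (c <? w ⟨$⟩ʳ r)}) rc∈D
... | c<wr , r<w⁻¹c = does-complete (c <? w ⟨$⟩ʳ r) c<wr , does-complete (r <? w ⟨$⟩ˡ c) r<w⁻¹c

AgreeAbove : ∀ {n} → Permutation′ n → Permutation′ n → Fin n → Set
AgreeAbove u v r = ∀ {j} → j < r → u ⟨$⟩ʳ j ≡ v ⟨$⟩ʳ j

inverse-agree : ∀ {n} (u v : Permutation′ n) {r c : Fin n} → AgreeAbove u v r →
                v ⟨$⟩ˡ c < r → u ⟨$⟩ˡ c ≡ v ⟨$⟩ˡ c
inverse-agree u v {c = c} agree j<r = begin
  u ⟨$⟩ˡ c                    ≡⟨ cong (u ⟨$⟩ˡ_) (inverseʳ v) ⟨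
  u ⟨$⟩ˡ (v ⟨$⟩ʳ (v ⟨$⟩ˡ c))  ≡⟨ cong (u ⟨$⟩ˡ_) (agree j<r) ⟨
  u ⟨$⟩ˡ (u ⟨$⟩ʳ (v ⟨$⟩ˡ c))  ≡⟨ inverseˡ u ⟩
  v ⟨$⟩ˡ c                    ∎
  where open ≡-Reasoning

taken-below : ∀ {n} (u v : Permutation′ n) {r c : Fin n} → AgreeAbove u v r →
              c ≢ v ⟨$⟩ʳ r → ¬ (u ⟨$⟩ˡ c < r) → r < v ⟨$⟩ˡ c
taken-below u v {r} {c} agree c≢vr not-above with Finₚ.<-cmp r (v ⟨$⟩ˡ c)
... | tri< r<v⁻¹c _ _ = r<v⁻¹c
... | tri≈ _ r≡v⁻¹c _ = ⊥-elim (c≢vr (trans (sym (inverseʳ v)) (cong (v ⟨$⟩ʳ_) (sym r≡v⁻¹c))))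
... | tri> _ _ v⁻¹c<r = ⊥-elim (not-above (subst (_< r) (sym (inverse-agree u v agree v⁻¹c<r)) v⁻¹c<r))

rothe-row-⊆ : ∀ {n} (u v : Permutation′ n) {r : Fin n} → AgreeAbove u v r →
              u ⟨$⟩ʳ r < v ⟨$⟩ʳ r → Rothe u r ⊆ Rothe v r
rothe-row-⊆ u v {r} agree ur<vr c rc∈Du with rothe-elim u rc∈Du
... | c<ur , r<u⁻¹c = rothe-intro v c<vr
        (taken-below u v agree (Finₚ.<⇒≢ c<vr) (Finₚ.<-asym r<u⁻¹c))
  where
  c<vr : c < v ⟨$⟩ʳ r
  c<vr = Finₚ.<-trans c<ur ur<vr

rothe-row-gap : ∀ {n} (u v : Permutation′ n) {r : Fin n} → AgreeAbove u v r →
                u ⟨$⟩ʳ r < v ⟨$⟩ʳ r →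
                ¬ T (Rothe u r (u ⟨$⟩ʳ r)) × T (Rothe v r (u ⟨$⟩ʳ r))
rothe-row-gap u v {r} agree ur<vr =
  (λ ∈Du → Finₚ.<-irrefl refl (proj₁ (rothe-elim u ∈Du))) ,
  rothe-intro v ur<vr (taken-below u v agree (Finₚ.<⇒≢ ur<vr) u⁻¹ur≮r)
  where
  u⁻¹ur≮r : ¬ (u ⟨$⟩ˡ (u ⟨$⟩ʳ r) < r)
  u⁻¹ur≮r = subst (λ j → ¬ (j < r)) (sym (inverseˡ u)) (Finₚ.<-irrefl refl)

code-smaller : ∀ {n} (u v : Permutation′ n) {r : Fin n} → AgreeAbove u v r →
               u ⟨$⟩ʳ r < v ⟨$⟩ʳ r → rowCount (Rothe u) r ℕ.< rowCount (Rothe v) r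
code-smaller u v {r} agree ur<vr with rothe-row-gap u v agree ur<vr
... | ∉Du , ∈Dv =
  count-strict (Rothe u r) (Rothe v r) (rothe-row-⊆ u v agree ur<vr) (u ⟨$⟩ʳ r) ∉Du ∈Dv

row-determined : ∀ {n} (u v : Permutation′ n) {r : Fin n} → AgreeAbove u v r →
                 rowCount (Rothe u) r ≡ rowCount (Rothe v) r → u ⟨$⟩ʳ r ≡ v ⟨$⟩ʳ r
row-determined u v {r} agree same with Finₚ.<-cmp (u ⟨$⟩ʳ r) (v ⟨$⟩ʳ r)
... | tri≈ _ ur≡vr _ = ur≡vr
... | tri< ur<vr _ _ = ⊥-elim (ℕₚ.<-irrefl same (code-smaller u v agree ur<vr))
... | tri> _ _ vr<ur = ⊥-elim (ℕₚ.<-irrefl (sym same) (code-smaller v u (sym ∘ agree) vr<ur))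

code-injective : ∀ {n} (u v : Permutation′ n) →
                 (∀ r → rowCount (Rothe u) r ≡ rowCount (Rothe v) r) → u ≈ v
code-injective u v same r = agree-from r (<-wellFounded r)
  where
  agree-from : ∀ r → Acc _<_ r → u ⟨$⟩ʳ r ≡ v ⟨$⟩ʳ r
  agree-from r (acc above) = row-determined u v (λ j<r → agree-from _ (above j<r)) (same r)

proposition5p15 : (n : ℕ) (u v : Permutation′ n) → len u ≡ len v
    → (∀ (i : Fin n) → theta (Rothe u) (finalSeg i) ≡ theta (Rothe v) (finalSeg i))
    → u ≈ v
proposition5p15 n u v _ sameTheta = code-injective u v sameCode
  where
  sameTailSums : ∀ i → tailSum (rowCount (Rothe u)) i ≡ tailSum (rowCount (Rothe v)) i
  sameTailSums i = begin
    tailSum (rowCount (Rothe u)) i  ≡⟨ theta-finalSeg (Rothe u) i ⟨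
    theta (Rothe u) (finalSeg i)    ≡⟨ sameTheta i ⟩
    theta (Rothe v) (finalSeg i)    ≡⟨ theta-finalSeg (Rothe v) i ⟩
    tailSum (rowCount (Rothe v)) i  ∎
    where open ≡-Reasoning
  sameCode : ∀ r → rowCount (Rothe u) r ≡ rowCount (Rothe v) r
  sameCode = tailSum-injective (rowCount (Rothe u)) (rowCount (Rothe v)) sameTailSums
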